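{- For every context-free grammar $\mathcal{G}$, there exists an integer-pair grammar $\mathcal{G}'$ that expresses $\mathcal{G}$, i.e. $L(\mathcal{G}')=L(\mathcal{G})$.
   Context: A context-free grammar is $\mathcal{G}=(\Sigma,\Gamma,\Delta,S)$ with terminals $\Sigma$, non-terminals $\Gamma$, rules $\Delta$ of the form $L\to R_1\cdots R_j$ ($L\in\Gamma$, $R_i\in\Sigma\cup\Gamma$), start symbol $S$; $L(\mathcal{G})$ is the set of terminal strings derivable from $S$. A grammar is in Chomsky normal form if every rule is $L\to R_1R_2$ with $R_1,R_2\in\Gamma$ or $L\to t$ with $t\in\Sigma$. An integer-pair grammar is a context-free grammar in Chomsky normal form whose non-terminal symbols are integer pairs $(a,d)$ and each of whose production rules has the form $(a,d)\to(a,b)(c,d)$ (the first component of the left symbol equals the first component of the first right symbol, and the second component of the left symbol equals the second component of the second right symbol) or $(a,d)\to t$ with $t$ terminal. A grammar $\mathcal{G}'$ expresses $\mathcal{G}$ if $L(\mathcal{G}')=L(\mathcal{G})$. -}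

module Defs where

open import Data.Nat using (ℕ)
open import Data.Fin using (Fin)
open import Data.Integer using (ℤ)
open import Data.List using (List; []; _∷_; _++_; map)
open import Data.List.Membership.Propositional using (_∈_)
open import Data.List.Relation.Unary.All using (All)
open import Data.Product using (_×_; _,_; ∃; ∃-syntax)
open import Data.Sum using (_⊎_; inj₁; inj₂)
open import Relation.Binary.PropositionalEquality using (_≡_; _≢_)
open import Relation.Binary.Construct.Closure.ReflexiveTransitive using (Star)
open import Function.Bundles using (_⇔_)

Symbol : Set → Set → Set
Symbol T N = T ⊎ N

Rule : Set → Set → Set
Rule T N = N × List (Symbol T N)

record Grammar (T N : Set) : Set where
  constructor grammar
  field
    rules : List (Rule T N)
    start : N
open Grammar public

data Step {T N : Set} (G : Grammar T N) : List (Symbol T N) → List (Symbol T N) → Set where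
  step : ∀ {L R} (u v : List (Symbol T N)) → (L , R) ∈ rules G →
         Step G (u ++ inj₂ L ∷ v) (u ++ R ++ v)

Derives : {T N : Set} → Grammar T N → List (Symbol T N) → List (Symbol T N) → Set
Derives G = Star (Step G)

_∈L_ : {T N : Set} → List T → Grammar T N → Set
w ∈L G = Derives G (inj₂ (start G) ∷ []) (map inj₁ w)

NonEmptyRules : {T N : Set} → Grammar T N → Set
NonEmptyRules G = All (λ r → Data.Product.proj₂ r ≢ []) (rules G)

CNFRule : {T N : Set} → Rule T N → Set
CNFRule {T} {N} (L , R) =
  (∃[ X ] ∃[ Y ] (R ≡ inj₂ X ∷ inj₂ Y ∷ [])) ⊎ (∃[ t ] (R ≡ inj₁ t ∷ []))

IsCNF : {T N : Set} → Grammar T N → Set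
IsCNF G = All CNFRule (rules G)

IntPairRule : {T : Set} → Rule T (ℤ × ℤ) → Set
IntPairRule (L , R) =
  (∃[ a ] ∃[ b ] ∃[ c ] ∃[ d ]
     (L ≡ (a , d) × R ≡ inj₂ (a , b) ∷ inj₂ (c , d) ∷ []))
  ⊎ (∃[ t ] (R ≡ inj₁ t ∷ []))

IsIntegerPairGrammar : {T : Set} → Grammar T (ℤ × ℤ) → Set
IsIntegerPairGrammar G = IsCNF G × All IntPairRule (rules G)

Expresses : {T N N' : Set} → Grammar T N' → Grammar T N → Set
Expresses G' G = ∀ w → (w ∈L G') ⇔ (w ∈L G)

-- The proof goes through parse trees: a string is in L(G) exactly when it has a parse tree
-- (Language.language⇔trees), and a map of parse trees that is mirrored rule by rule by
-- derivations transfers languages (Simulation).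
--
-- The non-terminals of the new grammar H name sentential forms of G:
--    an original non-terminal, a suffix of a right-hand side, or the terminal heading such a
--    suffix.  Long right-hand sides are split into head and rest, and unit rules are eliminated
--    by giving each non-terminal the rules of everything it reaches through unit rules; the
--    reachable set is finite and computable by bounded search (Reachability).  Any CNF grammar whose non-terminals are numbered injectively in ℕ is turned
--    into an integer-pair grammar, by letting pairs of Boolean-tagged numbers stand for
--    non-terminals so that the rule shape (a , d) → (a , b) (c , d) can always be met.
module Submission where

open import Defs
open import Data.Nat using (ℕ; zero; suc; _+_; _*_; _<_; _≤_; z≤n; s≤s)
open import Data.Nat.Properties using (+-suc; +-assoc; +-cancelˡ-≡; m≤m+n; <⇒≱; ≤-trans)
open import Data.Fin as Fin using (Fin; toℕ)
open import Data.Fin.Properties using (toℕ-injective; toℕ<n)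
open import Data.Integer using (ℤ; +_; -[1+_])
import Data.Integer.Properties as ℤ
open import Data.Bool using (Bool; true; false; not)
open import Data.Product using (_×_; ∃-syntax; _,_; proj₁; proj₂; ∃)
open import Data.Sum using (inj₁; inj₂)
open import Data.List using (List; []; _∷_; _++_; map; concatMap; length; drop; take; filter; lookup; allFin; upTo)
open import Data.List.Properties using (++-assoc; map-++; ++-identityʳ; length-++)
open import Data.List.Membership.Propositional using (_∈_; find; lose)
open import Data.List.Membership.Propositional.Properties
  using (∈-concatMap⁺; ∈-concatMap⁻; ∈-∃++; ∈-filter⁺; ∈-filter⁻; ∈-allFin; ∈-lookup; ∈-upTo⁺;
         ∈-map⁺; ∈-map⁻; ∈-++⁺ˡ; ∈-++⁺ʳ)
open import Relation.Binary.PropositionalEquality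
open import Relation.Binary.Construct.Closure.ReflexiveTransitive using (Star; ε; _◅_; _◅◅_; gmap)
open import Function.Bundles using (_⇔_; mk⇔; Equivalence)
open import Function using (_∘′_)
open import Data.Empty using (⊥-elim)
open import Relation.Nullary using (yes; no; ¬_)
open import Relation.Binary.Definitions using (DecidableEquality)
open import Data.List.Relation.Unary.Any as Any using (here; there)
open import Data.List.Relation.Unary.Any.Properties using (lookup-index)
import Data.List.Relation.Unary.All as All
open import Data.List.Relation.Unary.AllPairs using ([]; _∷_)
open import Data.List.Relation.Unary.Unique.Propositional using (Unique)
open import Data.List.Relation.Binary.Subset.Propositional using (_⊆_)

∈-concatMap-intro : {A B : Set} {f : A → List B} {x : A} {y : B} {xs : List A} →
                    x ∈ xs → y ∈ f x → y ∈ concatMap f xs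
∈-concatMap-intro {f = f} x∈xs y∈fx = ∈-concatMap⁺ f (lose x∈xs y∈fx)

∈-concatMap-elim : {A B : Set} (f : A → List B) (xs : List A) {y : B} →
                   y ∈ concatMap f xs → ∃ λ x → x ∈ xs × y ∈ f x
∈-concatMap-elim f xs y∈ = find (∈-concatMap⁻ f {xs} y∈)

module Derivations {T N : Set} (G : Grammar T N) where

  Form : Set
  Form = List (Symbol T N)

  step-prefix : ∀ (γ : Form) {α β} → Step G α β → Step G (γ ++ α) (γ ++ β)
  step-prefix γ (step u v r) = subst₂ (Step G) (++-assoc γ u _) (++-assoc γ u _) (step (γ ++ u) v r)

  step-suffix : ∀ (γ : Form) {α β} → Step G α β → Step G (α ++ γ) (β ++ γ)
  step-suffix γ (step {R = R} u v r) =
    subst₂ (Step G) (sym (++-assoc u _ γ))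
      (sym (trans (++-assoc u (R ++ v) γ) (cong (u ++_) (++-assoc R v γ))))
      (step u (v ++ γ) r)

  derives-≡ : ∀ {α β : Form} → α ≡ β → Derives G α β
  derives-≡ refl = ε

  derives-++ : ∀ {α β γ δ : Form} → Derives G α β → Derives G γ δ → Derives G (α ++ γ) (β ++ δ)
  derives-++ {β = β} {γ = γ} d e = gmap (_++ γ) (step-suffix γ) d ◅◅ gmap (β ++_) (step-prefix β) e

module ParseTrees {T N : Set} (G : Grammar T N) where

  data Tree : N → List T → Set
  data Forest : List (Symbol T N) → List T → Set

  data Tree where
    node : ∀ {X R w} → (X , R) ∈ rules G → Forest R w → Tree X w

  data Forest where
    fnil : Forest [] []
    fterm : ∀ {t α w} → Forest α w → Forest (inj₁ t ∷ α) (t ∷ w)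
    fnt : ∀ {X α w₁ w₂} → Tree X w₁ → Forest α w₂ → Forest (inj₂ X ∷ α) (w₁ ++ w₂)

  forest-++ : ∀ {α β w₁ w₂} → Forest α w₁ → Forest β w₂ → Forest (α ++ β) (w₁ ++ w₂)
  forest-++ fnil g = g
  forest-++ (fterm f) g = fterm (forest-++ f g)
  forest-++ (fnt {w₁ = w₁} {w₂ = w₂} t f) g =
    subst (Forest _) (sym (++-assoc w₁ w₂ _)) (fnt t (forest-++ f g))

  forest-split : ∀ α {β w} → Forest (α ++ β) w →
                 ∃ λ w₁ → ∃ λ w₂ → w ≡ w₁ ++ w₂ × Forest α w₁ × Forest β w₂
  forest-split [] {w = w} f = [] , w , refl , fnil , f
  forest-split (inj₁ t ∷ α) (fterm f) with w₁ , w₂ , refl , f₁ , f₂ ← forest-split α f =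
    t ∷ w₁ , w₂ , refl , fterm f₁ , f₂
  forest-split (inj₂ X ∷ α) (fnt {w₁ = v} t f) with w₁ , w₂ , refl , f₁ , f₂ ← forest-split α f =
    v ++ w₁ , w₂ , sym (++-assoc v w₁ w₂) , fnt t f₁ , f₂

  forest-unstep : ∀ {α β w} → Step G α β → Forest β w → Forest α w
  forest-unstep (step {R = R} u v r) f
    with wu , wRv , refl , fu , fRv ← forest-split u f
    with wR , wv , refl , fR , fv ← forest-split R fRv =
    forest-++ fu (fnt (node r fR) fv)

  leaves : ∀ w → Forest (map inj₁ w) w
  leaves [] = fnil
  leaves (t ∷ w) = fterm (leaves w)

  derives→forest : ∀ {α w} → Derives G α (map inj₁ w) → Forest α w
  derives→forest {w = w} ε = leaves w
  derives→forest (s ◅ d) = forest-unstep s (derives→forest d)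

module Interpretation {T N K : Set} (⟦_⟧ : K → List (Symbol T N)) where

  ⟦_⟧ˢ : Symbol T K → List (Symbol T N)
  ⟦ inj₁ t ⟧ˢ = inj₁ t ∷ []
  ⟦ inj₂ h ⟧ˢ = ⟦ h ⟧

  ⟦_⟧* : List (Symbol T K) → List (Symbol T N)
  ⟦_⟧* = concatMap ⟦_⟧ˢ

module Simulation {T N K : Set} (G : Grammar T N) (H : Grammar T K)
                  (⟦_⟧ : K → List (Symbol T N)) where
  open Derivations G using (derives-++)
  open ParseTrees H
  open Interpretation ⟦_⟧ public

  module _ (rule-sound : ∀ {h R} → (h , R) ∈ rules H → Derives G ⟦ h ⟧ ⟦ R ⟧*) where
    tree-sound : ∀ {h w} → Tree h w → Derives G ⟦ h ⟧ (map inj₁ w)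
    forest-sound : ∀ {R w} → Forest R w → Derives G ⟦ R ⟧* (map inj₁ w)

    tree-sound (node r f) = rule-sound r ◅◅ forest-sound f

    forest-sound fnil = ε
    forest-sound (fterm {t} f) = derives-++ {α = inj₁ t ∷ []} ε (forest-sound f)
    forest-sound (fnt {w₁ = w₁} {w₂} t f) =
      subst (Derives G _) (sym (map-++ inj₁ w₁ w₂)) (derives-++ (tree-sound t) (forest-sound f))

module Language {T N : Set} (G : Grammar T N) where
  open Derivations G using (derives-≡)
  open ParseTrees G
  open Simulation G G (λ X → inj₂ X ∷ [])

  ⟦⟧*-identity : ∀ R → ⟦ R ⟧* ≡ R
  ⟦⟧*-identity [] = refl
  ⟦⟧*-identity (inj₁ t ∷ R) = cong (inj₁ t ∷_) (⟦⟧*-identity R)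
  ⟦⟧*-identity (inj₂ X ∷ R) = cong (inj₂ X ∷_) (⟦⟧*-identity R)

  one-step : ∀ {X R} → (X , R) ∈ rules G → Derives G (inj₂ X ∷ []) ⟦ R ⟧*
  one-step {R = R} r = step [] [] r ◅ derives-≡ (trans (++-identityʳ R) (sym (⟦⟧*-identity R)))

  language⇔trees : ∀ w → (w ∈L G) ⇔ Tree (start G) w
  language⇔trees w = mk⇔ to (tree-sound one-step)
    where
    to : w ∈L G → Tree (start G) w
    to d with fnt {w₁ = v} t fnil ← derives→forest d = subst (Tree _) (sym (++-identityʳ v)) t

expresses-trans : {T N₁ N₂ N₃ : Set} {G₁ : Grammar T N₁} {G₂ : Grammar T N₂} {G₃ : Grammar T N₃} →
                  Expresses G₁ G₂ → Expresses G₂ G₃ → Expresses G₁ G₃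
expresses-trans e₁₂ e₂₃ w = mk⇔ (Equivalence.to (e₂₃ w) ∘′ Equivalence.to (e₁₂ w))
                                (Equivalence.from (e₁₂ w) ∘′ Equivalence.from (e₂₃ w))

∈-remove : {A : Set} (us : List A) {vs : List A} {x y : A} → y ∈ us ++ x ∷ vs → y ≢ x → y ∈ us ++ vs
∈-remove [] (here refl) y≢x = ⊥-elim (y≢x refl)
∈-remove [] (there p) _ = p
∈-remove (u ∷ us) (here refl) _ = here refl
∈-remove (u ∷ us) (there p) y≢x = there (∈-remove us p y≢x)

unique-length : {A : Set} {xs ys : List A} → Unique xs → xs ⊆ ys → length xs ≤ length ys
unique-length [] _ = z≤n
unique-length {xs = x ∷ xs} (x∉xs ∷ uniq) sub with us , vs , refl ← ∈-∃++ (sub (here refl)) =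
  subst (suc (length xs) ≤_) (sym length-insert) (s≤s (unique-length uniq sub′))
  where
  sub′ : xs ⊆ us ++ vs
  sub′ p = ∈-remove us (sub (there p)) (λ y≡x → All.lookup x∉xs p (sym y≡x))
  length-insert : length (us ++ x ∷ vs) ≡ suc (length (us ++ vs))
  length-insert = begin
    length (us ++ x ∷ vs)        ≡⟨ length-++ us ⟩
    length us + suc (length vs)  ≡⟨ +-suc (length us) (length vs) ⟩
    suc (length us + length vs)  ≡⟨ cong suc (sym (length-++ us)) ⟩
    suc (length (us ++ vs))      ∎
    where open ≡-Reasoning

-- Reachability along a relation E on a type with decidable equality and a complete enumeration:
-- everything reachable at all is reachable in at most (length enum) steps, so the finite
-- list  reachable x  computed by bounded search contains exactly the vertices reachable from x.
module Reachability {A : Set} (_≟_ : DecidableEquality A)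
                    (enum : List A) (enum-complete : ∀ x → x ∈ enum)
                    (E : A → A → Set) (next : A → List A)
                    (next-sound : ∀ {x y} → y ∈ next x → E x y)
                    (next-complete : ∀ {x y} → E x y → y ∈ next x) where
  open import Data.List.Membership.DecPropositional _≟_ using (_∈?_)

  within : ℕ → A → List A
  within zero x = x ∷ []
  within (suc k) x = x ∷ concatMap (within k) (next x)

  within-sound : ∀ k {x y} → y ∈ within k x → Star E x y
  within-sound zero (here refl) = ε
  within-sound (suc k) (here refl) = ε
  within-sound (suc k) (there p) with z , z∈next , q ← ∈-concatMap-elim (within k) (next _) p =
    next-sound z∈next ◅ within-sound k q

  reachable : A → List A
  reachable = within (length enum)

  reachable-sound : ∀ {x y} → y ∈ reachable x → Star E x y
  reachable-sound = within-sound (length enum)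

  data Path : A → A → List A → Set where
    [] : ∀ {x} → Path x x []
    _∷_ : ∀ {x y z vs} → E x y → Path y z vs → Path x z (x ∷ vs)

  path : ∀ {x y} → Star E x y → ∃ (Path x y)
  path ε = [] , []
  path (e ◅ s) with vs , p ← path s = _ , e ∷ p

  path-within : ∀ k {x z vs} → Path x z vs → length vs ≤ k → z ∈ within k x
  path-within zero [] _ = here refl
  path-within (suc k) [] _ = here refl
  path-within (suc k) (e ∷ p) (s≤s ≤k) = there (∈-concatMap-intro (next-complete e) (path-within k p ≤k))

  path-from : ∀ {x y z vs} → Path y z vs → x ∈ vs → Unique vs → ∃ λ vs′ → Path x z vs′ × Unique vs′
  path-from (e ∷ p) (here refl) uniq = _ , e ∷ p , uniq
  path-from (e ∷ p) (there x∈) (_ ∷ uniq) = path-from p x∈ uniq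

  simple-path : ∀ {x z vs} → Path x z vs → ∃ λ vs′ → Path x z vs′ × Unique vs′
  simple-path [] = [] , [] , []
  simple-path {x} (e ∷ p) with vs′ , p′ , uniq ← simple-path p with x ∈? vs′
  ... | yes x∈ = path-from p′ x∈ uniq
  ... | no x∉ = x ∷ vs′ , e ∷ p′ , All.tabulate (λ y∈ x≡y → x∉ (subst (_∈ vs′) (sym x≡y) y∈)) ∷ uniq

  reachable-complete : ∀ {x y} → Star E x y → y ∈ reachable x
  reachable-complete s with vs , p ← path s with vs′ , p′ , uniq ← simple-path p =
    path-within (length enum) p′ (unique-length uniq (λ {v} _ → enum-complete v))

drop-suc : {A : Set} (k : ℕ) (xs : List A) {y : A} {ys : List A} → drop k xs ≡ y ∷ ys → drop (suc k) xs ≡ ys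
drop-suc zero (x ∷ xs) refl = refl
drop-suc (suc k) (x ∷ xs) e = drop-suc k xs e

drop-nonempty : {A : Set} (k : ℕ) (xs : List A) {y : A} {ys : List A} → drop k xs ≡ y ∷ ys → k < length xs
drop-nonempty zero (x ∷ xs) _ = s≤s z≤n
drop-nonempty (suc k) (x ∷ xs) e = s≤s (drop-nonempty k xs e)

radix-injective : ∀ B {x x′ y y′} → y < B → y′ < B → x * B + y ≡ x′ * B + y′ → x ≡ x′ × y ≡ y′
radix-injective B {zero} {zero} _ _ e = refl , e
radix-injective B {zero} {suc x′} {y} {y′} y<B _ e =
  ⊥-elim (<⇒≱ y<B (subst (B ≤_) (sym e) (≤-trans (m≤m+n B (x′ * B)) (m≤m+n (B + x′ * B) y′))))
radix-injective B {suc x} {zero} {y} {y′} _ y′<B e =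
  ⊥-elim (<⇒≱ y′<B (subst (B ≤_) e (≤-trans (m≤m+n B (x * B)) (m≤m+n (B + x * B) y))))
radix-injective B {suc x} {suc x′} {y} {y′} y<B y′<B e
  with refl , refl ← radix-injective B {x} {x′} y<B y′<B
         (+-cancelˡ-≡ B _ _ (trans (sym (+-assoc B (x * B) y)) (trans e (+-assoc B (x′ * B) y′)))) =
  refl , refl

module ChomskyNormalForm {T : Set} (n : ℕ) (G : Grammar T (Fin n)) (nonEmpty : NonEmptyRules G) where
  open import Data.List.Membership.DecPropositional (Fin._≟_ {n}) using (_∈?_)

  Sym : Set
  Sym = Symbol T (Fin n)

  nR : ℕ
  nR = length (rules G)

  lhs : Fin nR → Fin n
  lhs i = proj₁ (lookup (rules G) i)

  rhs : Fin nR → List Sym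
  rhs i = proj₂ (lookup (rules G) i)

  UnitRule : Fin n → Fin n → Set
  UnitRule X Y = (X , inj₂ Y ∷ []) ∈ rules G

  unitTarget : Rule T (Fin n) → List (Fin n)
  unitTarget (_ , []) = []
  unitTarget (_ , inj₁ _ ∷ _) = []
  unitTarget (_ , inj₂ Y ∷ []) = Y ∷ []
  unitTarget (_ , inj₂ _ ∷ _ ∷ _) = []

  unitSuccessors : Fin n → List (Fin n)
  unitSuccessors X = concatMap unitTarget (filter (λ r → proj₁ r Fin.≟ X) (rules G))

  unitSuccessors-sound : ∀ {X Y} → Y ∈ unitSuccessors X → UnitRule X Y
  unitSuccessors-sound {X} p with (_ , inj₂ _ ∷ []) , r∈ , here refl ← ∈-concatMap-elim unitTarget _ p
                         with r∈G , refl ← ∈-filter⁻ (λ r → proj₁ r Fin.≟ X) r∈ = r∈G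

  unitSuccessors-complete : ∀ {X Y} → UnitRule X Y → Y ∈ unitSuccessors X
  unitSuccessors-complete {X} r = ∈-concatMap-intro (∈-filter⁺ (λ r → proj₁ r Fin.≟ X) r refl) (here refl)

  open Reachability Fin._≟_ (allFin n) ∈-allFin UnitRule unitSuccessors
                    unitSuccessors-sound unitSuccessors-complete
    using (reachable; reachable-sound; reachable-complete)

  unit-derives : ∀ {X Y} → Star UnitRule X Y → Derives G (inj₂ X ∷ []) (inj₂ Y ∷ [])
  unit-derives = gmap (λ X → inj₂ X ∷ []) (λ r → step [] [] r)

  -- Non-terminals of the normal form and the sentential forms of G they stand for:
  -- nt X stands for X, and for the suffix of rule i from position k on there is
  -- suf i k (the whole suffix) and lit i k (its first symbol, used when that is a terminal).
  data Nonterminal : Set where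
    nt : Fin n → Nonterminal
    lit : Fin nR → ℕ → Nonterminal
    suf : Fin nR → ℕ → Nonterminal

  ⟦_⟧ : Nonterminal → List Sym
  ⟦ nt X ⟧ = inj₂ X ∷ []
  ⟦ lit i k ⟧ = take 1 (drop k (rhs i))
  ⟦ suf i k ⟧ = drop k (rhs i)

  open Interpretation ⟦_⟧ using (⟦_⟧*)
  open Derivations G using (derives-≡)

  HSym : Set
  HSym = Symbol T Nonterminal

  headOf : Fin nR → ℕ → Sym → Nonterminal
  headOf i k (inj₁ _) = lit i k
  headOf i k (inj₂ X) = nt X

  binarise : Fin nR → ℕ → List Sym → List (List HSym)
  binarise i k [] = []
  binarise i k (s ∷ s′ ∷ ρ) = (inj₂ (headOf i k s) ∷ inj₂ (suf i (suc k)) ∷ []) ∷ []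
  binarise i k (inj₁ t ∷ []) = (inj₁ t ∷ []) ∷ []
  binarise i k (inj₂ X ∷ []) = []

  reachableRules : Fin n → List (Fin nR)
  reachableRules X = filter (λ i → lhs i ∈? reachable X) (allFin nR)

  -- X inherits the binarised non-unit rules of every non-terminal it unit-reaches
  unitClosed : Fin n → List (List HSym)
  unitClosed X = concatMap (λ i → binarise i 0 (rhs i)) (reachableRules X)

  literal : List Sym → List (List HSym)
  literal [] = []
  literal (inj₁ t ∷ _) = (inj₁ t ∷ []) ∷ []
  literal (inj₂ _ ∷ _) = []

  -- the right-hand sides of suf i k: a lone non-terminal X behaves like nt X
  suffixRhs : Fin nR → ℕ → List Sym → List (List HSym)
  suffixRhs i k [] = []
  suffixRhs i k (s ∷ s′ ∷ ρ) = binarise i k (s ∷ s′ ∷ ρ)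
  suffixRhs i k (inj₁ t ∷ []) = binarise i k (inj₁ t ∷ [])
  suffixRhs i k (inj₂ X ∷ []) = unitClosed X

  rhsOf : Nonterminal → List (List HSym)
  rhsOf (nt X) = unitClosed X
  rhsOf (lit i k) = literal (drop k (rhs i))
  rhsOf (suf i k) = suffixRhs i k (drop k (rhs i))

  registered : List Nonterminal
  registered = map nt (allFin n) ++
               concatMap (λ i → concatMap (λ k → lit i k ∷ suf i k ∷ []) (upTo (length (rhs i)))) (allFin nR)

  H : Grammar T Nonterminal
  H = grammar (concatMap (λ h → map (h ,_) (rhsOf h)) registered) (nt (start G))

  rule-of-H : ∀ {h R} → (h , R) ∈ rules H → R ∈ rhsOf h
  rule-of-H p with h , _ , q ← ∈-concatMap-elim (λ h → map (h ,_) (rhsOf h)) registered p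
              with R , R∈ , refl ← ∈-map⁻ (h ,_) q = R∈

  rule-in-H : ∀ {h R} → h ∈ registered → R ∈ rhsOf h → (h , R) ∈ rules H
  rule-in-H {h} h∈ R∈ = ∈-concatMap-intro h∈ (∈-map⁺ (h ,_) R∈)

  nt-registered : ∀ X → nt X ∈ registered
  nt-registered X = ∈-++⁺ˡ (∈-map⁺ nt (∈-allFin X))

  position-registered : ∀ i k → k < length (rhs i) → lit i k ∈ registered × suf i k ∈ registered
  position-registered i k k< = in-positions (here refl) , in-positions (there (here refl))
    where
    in-positions : ∀ {h} → h ∈ lit i k ∷ suf i k ∷ [] → h ∈ registered
    in-positions h∈ = ∈-++⁺ʳ (map nt (allFin n))
      (∈-concatMap-intro (∈-allFin i) (∈-concatMap-intro (∈-upTo⁺ k<) h∈))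

  binarise-cnf : ∀ h i k ρ {R} → R ∈ binarise i k ρ → CNFRule (h , R)
  binarise-cnf h i k (inj₁ t ∷ []) (here refl) = inj₂ (t , refl)
  binarise-cnf h i k (s ∷ s′ ∷ ρ) (here refl) = inj₁ (_ , _ , refl)

  unitClosed-cnf : ∀ h X {R} → R ∈ unitClosed X → CNFRule (h , R)
  unitClosed-cnf h X R∈
    with i , _ , R∈i ← ∈-concatMap-elim (λ i → binarise i 0 (rhs i)) (reachableRules X) R∈ =
    binarise-cnf h i 0 (rhs i) R∈i

  rhsOf-cnf : ∀ h {R} → R ∈ rhsOf h → CNFRule (h , R)
  rhsOf-cnf (nt X) R∈ = unitClosed-cnf (nt X) X R∈
  rhsOf-cnf (lit i k) R∈ = literal-cnf (drop k (rhs i)) R∈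
    where
    literal-cnf : ∀ ρ {R} → R ∈ literal ρ → CNFRule (lit i k , R)
    literal-cnf (inj₁ t ∷ _) (here refl) = inj₂ (t , refl)
  rhsOf-cnf (suf i k) R∈ = suffix-cnf (drop k (rhs i)) R∈
    where
    suffix-cnf : ∀ ρ {R} → R ∈ suffixRhs i k ρ → CNFRule (suf i k , R)
    suffix-cnf (inj₂ X ∷ []) R∈ = unitClosed-cnf (suf i k) X R∈
    suffix-cnf (inj₁ t ∷ []) R∈ = binarise-cnf (suf i k) i k (inj₁ t ∷ []) R∈
    suffix-cnf (s ∷ s′ ∷ ρ) R∈ = binarise-cnf (suf i k) i k (s ∷ s′ ∷ ρ) R∈

  H-cnf : IsCNF H
  H-cnf = All.tabulate λ { {h , R} r → rhsOf-cnf h (rule-of-H r) }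

  headOf-exact : ∀ i k {s ρ} → drop k (rhs i) ≡ s ∷ ρ → ⟦ headOf i k s ⟧ ≡ s ∷ []
  headOf-exact i k {inj₁ t} e = cong (take 1) e
  headOf-exact i k {inj₂ X} e = refl

  binarise-exact : ∀ i k ρ {R} → drop k (rhs i) ≡ ρ → R ∈ binarise i k ρ → ⟦ R ⟧* ≡ ρ
  binarise-exact i k (inj₁ t ∷ []) _ (here refl) = refl
  binarise-exact i k (s ∷ s′ ∷ ρ) e (here refl) =
    cong₂ _++_ (headOf-exact i k e) (trans (++-identityʳ _) (drop-suc k (rhs i) e))

  -- X unit-derives the left-hand side of the rule used, which then takes one step
  unitClosed-sound : ∀ X {R} → R ∈ unitClosed X → Derives G (inj₂ X ∷ []) ⟦ R ⟧*
  unitClosed-sound X R∈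
    with i , i∈ , R∈i ← ∈-concatMap-elim (λ i → binarise i 0 (rhs i)) (reachableRules X) R∈
    with _ , reach ← ∈-filter⁻ (λ i → lhs i ∈? reachable X) {xs = allFin nR} i∈ =
    unit-derives (reachable-sound reach) ◅◅
    step [] [] (∈-lookup i) ◅
    derives-≡ (trans (++-identityʳ (rhs i)) (sym (binarise-exact i 0 (rhs i) refl R∈i)))

  rhsOf-sound : ∀ h {R} → R ∈ rhsOf h → Derives G ⟦ h ⟧ ⟦ R ⟧*
  rhsOf-sound (nt X) R∈ = unitClosed-sound X R∈
  rhsOf-sound (lit i k) R∈ = literal-sound (drop k (rhs i)) R∈
    where
    literal-sound : ∀ ρ {R} → R ∈ literal ρ → Derives G (take 1 ρ) ⟦ R ⟧*
    literal-sound (inj₁ t ∷ _) (here refl) = ε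
  rhsOf-sound (suf i k) R∈ = suffix-sound (drop k (rhs i)) refl R∈
    where
    suffix-sound : ∀ ρ {R} → drop k (rhs i) ≡ ρ → R ∈ suffixRhs i k ρ → Derives G ρ ⟦ R ⟧*
    suffix-sound (inj₂ X ∷ []) _ R∈ = unitClosed-sound X R∈
    suffix-sound (inj₁ t ∷ []) e R∈ = derives-≡ (sym (binarise-exact i k _ e R∈))
    suffix-sound (s ∷ s′ ∷ ρ) e R∈ = derives-≡ (sym (binarise-exact i k _ e R∈))

  module TG = ParseTrees G
  module TH = ParseTrees H

  reroot : ∀ {h h′ w} → h ∈ registered → rhsOf h′ ⊆ rhsOf h → TH.Tree h′ w → TH.Tree h w
  reroot h∈ sub (TH.node r f) = TH.node (rule-in-H h∈ (sub (rule-of-H r))) f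

  data IsUnit : List Sym → Set where
    unit : ∀ X → IsUnit (inj₂ X ∷ [])

  suffixRhs-nonunit : ∀ i k ρ → ¬ IsUnit ρ → suffixRhs i k ρ ≡ binarise i k ρ
  suffixRhs-nonunit i k [] _ = refl
  suffixRhs-nonunit i k (s ∷ s′ ∷ ρ) _ = refl
  suffixRhs-nonunit i k (inj₁ t ∷ []) _ = refl
  suffixRhs-nonunit i k (inj₂ X ∷ []) nonunit = ⊥-elim (nonunit (unit X))

  rule-at-index : ∀ {Y R} (r : (Y , R) ∈ rules G) → lhs (Any.index r) ≡ Y × rhs (Any.index r) ≡ R
  rule-at-index r = cong proj₁ (sym (lookup-index r)) , cong proj₂ (sym (lookup-index r))

  suffix-rule : ∀ {i k s ρ R} → drop k (rhs i) ≡ s ∷ ρ → R ∈ suffixRhs i k (s ∷ ρ) → (suf i k , R) ∈ rules H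
  suffix-rule {i} {k} {R = R} e R∈ =
    rule-in-H (proj₂ (position-registered i k (drop-nonempty k (rhs i) e)))
              (subst (λ ρ → R ∈ suffixRhs i k ρ) (sym e) R∈)

  literal-tree : ∀ {i k t ρ} → drop k (rhs i) ≡ inj₁ t ∷ ρ → TH.Tree (lit i k) (t ∷ [])
  literal-tree {i} {k} e =
    TH.node (rule-in-H (proj₁ (position-registered i k (drop-nonempty k (rhs i) e)))
                       (subst (λ ρ → _ ∈ literal ρ) (sym e) (here refl)))
            (TH.fterm TH.fnil)

  tree-complete : ∀ {X Y w} → Star UnitRule X Y → TG.Tree Y w → TH.Tree (nt X) w
  rule-complete : ∀ {X Y s ρ w} → Star UnitRule X Y → (r : (Y , s ∷ ρ) ∈ rules G) →
                  ¬ IsUnit (s ∷ ρ) → TG.Forest (s ∷ ρ) w → TH.Tree (nt X) w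
  suffix-complete : ∀ {i k s ρ w} → drop k (rhs i) ≡ s ∷ ρ → TG.Forest (s ∷ ρ) w → TH.Tree (suf i k) w

  -- unit rules are absorbed by extending the unit path; other rules are binarised
  tree-complete u (TG.node {R = []} r f) = ⊥-elim (All.lookup nonEmpty r refl)
  tree-complete u (TG.node {R = inj₂ Z ∷ []} r (TG.fnt {w₁ = v} t TG.fnil)) =
    subst (TH.Tree _) (sym (++-identityʳ v)) (tree-complete (u ◅◅ r ◅ ε) t)
  tree-complete u (TG.node {R = inj₁ t ∷ []} r f) = rule-complete u r (λ ()) f
  tree-complete u (TG.node {R = s ∷ s′ ∷ ρ} r f) = rule-complete u r (λ ()) f

  rule-complete {X} u r nonunit f =
    reroot (nt-registered X) closure (suffix-complete {i} {0} (proj₂ (rule-at-index r)) f)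
    where
    i = Any.index r
    closure : rhsOf (suf i 0) ⊆ unitClosed X
    closure R∈ = ∈-concatMap-intro
      (∈-filter⁺ (λ i → lhs i ∈? reachable X) (∈-allFin i)
                 (subst (_∈ reachable X) (sym (proj₁ (rule-at-index r))) (reachable-complete u)))
      (subst (_ ∈_) (suffixRhs-nonunit i 0 (rhs i) (nonunit ∘′ subst IsUnit (proj₂ (rule-at-index r)))) R∈)

  suffix-complete e (TG.fterm TG.fnil) = TH.node (suffix-rule e (here refl)) (TH.fterm TH.fnil)
  suffix-complete {i} {k} e (TG.fterm {t} {_ ∷ _} {w} f) =
    subst (TH.Tree _) (cong (t ∷_) (++-identityʳ w))
      (TH.node (suffix-rule e (here refl))
        (TH.fnt (literal-tree e) (TH.fnt (suffix-complete (drop-suc k (rhs i) e) f) TH.fnil)))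
  suffix-complete {i} {k} e (TG.fnt {X} {w₁ = v} t TG.fnil) =
    subst (TH.Tree _) (sym (++-identityʳ v))
      (reroot (proj₂ (position-registered i k (drop-nonempty k (rhs i) e)))
              (subst (λ ρ → _ ∈ suffixRhs i k ρ) (sym e)) (tree-complete ε t))
  suffix-complete {i} {k} e (TG.fnt {α = _ ∷ _} {w₁ = v} {w} t f) =
    subst (TH.Tree _) (cong (v ++_) (++-identityʳ w))
      (TH.node (suffix-rule e (here refl))
        (TH.fnt (tree-complete ε t) (TH.fnt (suffix-complete (drop-suc k (rhs i) e) f) TH.fnil)))

  H-expresses-G : Expresses H G
  H-expresses-G w =
    mk⇔ (tree-sound (λ {h} r → rhsOf-sound h (rule-of-H r)) ∘′ Equivalence.to (LH.language⇔trees w))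
        (Equivalence.from (LH.language⇔trees w) ∘′ tree-complete ε ∘′ Equivalence.to (LG.language⇔trees w))
    where
    module LH = Language H
    module LG = Language G
    open Simulation G H ⟦_⟧ using (tree-sound)

  position : Fin nR → ℕ → ℕ
  position i k = k * nR + toℕ i

  position-injective : ∀ {i i′ k k′} → position i k ≡ position i′ k′ → i ≡ i′ × k ≡ k′
  position-injective {i} {i′} {k} {k′} e
    with refl , i≡i′ ← radix-injective nR {k} {k′} (toℕ<n i) (toℕ<n i′) e =
    toℕ-injective i≡i′ , refl

  number : Nonterminal → ℕ
  number (nt X) = toℕ X
  number (lit i k) = position i k
  number (suf i k) = position i k

  tag : Nonterminal → ℕ
  tag (nt _) = 0
  tag (lit _ _) = 1
  tag (suf _ _) = 2

  tag<3 : ∀ h → tag h < 3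
  tag<3 (nt _) = s≤s z≤n
  tag<3 (lit _ _) = s≤s (s≤s z≤n)
  tag<3 (suf _ _) = s≤s (s≤s (s≤s z≤n))

  encode : Nonterminal → ℕ
  encode h = number h * 3 + tag h

  encode-injective : ∀ {h h′} → encode h ≡ encode h′ → h ≡ h′
  encode-injective {h} {h′} e with radix-injective 3 {number h} {number h′} (tag<3 h) (tag<3 h′) e
  encode-injective {nt X} {nt Y} e | X≡Y , _ = cong nt (toℕ-injective X≡Y)
  encode-injective {lit i k} {lit i′ k′} e | p , _ with refl , refl ← position-injective {i} {i′} {k} {k′} p = refl
  encode-injective {suf i k} {suf i′ k′} e | p , _ with refl , refl ← position-injective {i} {i′} {k} {k′} p = refl
  encode-injective {nt _} {lit _ _} e | _ , ()
  encode-injective {nt _} {suf _ _} e | _ , ()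
  encode-injective {lit _ _} {nt _} e | _ , ()
  encode-injective {lit _ _} {suf _ _} e | _ , ()
  encode-injective {suf _ _} {nt _} e | _ , ()
  encode-injective {suf _ _} {lit _ _} e | _ , ()

-- Non-terminals of H carry a Boolean tag
-- and are numbered injectively in ℤ (tag true: non-negative, tag false: negative).  A pair
-- (a , d) of tagged non-terminals stands for d's non-terminal when the tags agree and for a's
-- otherwise.  For every pair (a , d) standing for h, a rule h → Y Z becomes
--   (a , d) → (a , (Y , tag a)) ((Z , not (tag d)) , d),
-- whose first pair stands for Y (equal tags) and whose second stands for Z (different tags).
module IntegerPairs {T K : Set} (H : Grammar T K) (cnf : IsCNF H)
                    (encode : K → ℕ) (encode-injective : ∀ {x y} → encode x ≡ encode y → x ≡ y) where

  Tagged : Set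
  Tagged = K × Bool

  ⌜_⌝ : Tagged → ℤ
  ⌜ h , true ⌝ = + encode h
  ⌜ h , false ⌝ = -[1+ encode h ]

  ⌜⌝-injective : ∀ {a b} → ⌜ a ⌝ ≡ ⌜ b ⌝ → a ≡ b
  ⌜⌝-injective {h , true} {h′ , true} e = cong (_, true) (encode-injective (ℤ.+-injective e))
  ⌜⌝-injective {h , false} {h′ , false} e = cong (_, false) (encode-injective (ℤ.-[1+-injective e))
  ⌜⌝-injective {h , true} {h′ , false} ()
  ⌜⌝-injective {h , false} {h′ , true} ()

  meaning : Tagged → Tagged → K
  meaning (a , true) (d , true) = d
  meaning (a , false) (d , false) = d
  meaning (a , true) (d , false) = a
  meaning (a , false) (d , true) = a

  meaning-agree : ∀ a b Y → meaning (a , b) (Y , b) ≡ Y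
  meaning-agree a true Y = refl
  meaning-agree a false Y = refl

  meaning-differ : ∀ Z b d → meaning (Z , not b) (d , b) ≡ Z
  meaning-differ Z true d = refl
  meaning-differ Z false d = refl

  nonterminalOf : Symbol T K → List K
  nonterminalOf (inj₁ _) = []
  nonterminalOf (inj₂ Y) = Y ∷ []

  nonterminals : List K
  nonterminals = start H ∷ concatMap (λ r → concatMap nonterminalOf (proj₂ r)) (rules H)

  rhs-nonterminal : ∀ {h R Y} → (h , R) ∈ rules H → inj₂ Y ∈ R → Y ∈ nonterminals
  rhs-nonterminal r Y∈R = there (∈-concatMap-intro r (∈-concatMap-intro Y∈R (here refl)))

  pairsWith : K → K → List (Tagged × Tagged)
  pairsWith h q = ((q , true) , (h , true)) ∷ ((q , false) , (h , false)) ∷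
                  ((h , true) , (q , false)) ∷ ((h , false) , (q , true)) ∷ []

  pairsFor : K → List (Tagged × Tagged)
  pairsFor h = concatMap (pairsWith h) nonterminals

  pairsFor-meaning : ∀ {h a d} → (a , d) ∈ pairsFor h → meaning a d ≡ h
  pairsFor-meaning {h} p with _ , _ , q ← ∈-concatMap-elim (pairsWith h) nonterminals p with q
  ... | here refl = refl
  ... | there (here refl) = refl
  ... | there (there (here refl)) = refl
  ... | there (there (there (here refl))) = refl

  pairsFor-complete : ∀ a d → proj₁ a ∈ nonterminals → proj₁ d ∈ nonterminals →
                      (a , d) ∈ pairsFor (meaning a d)
  pairsFor-complete (_ , true) (d , true) a∈ _ = ∈-concatMap-intro {f = pairsWith d} a∈ (here refl)
  pairsFor-complete (_ , false) (d , false) a∈ _ = ∈-concatMap-intro {f = pairsWith d} a∈ (there (here refl))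
  pairsFor-complete (a , true) (_ , false) _ d∈ = ∈-concatMap-intro {f = pairsWith a} d∈ (there (there (here refl)))
  pairsFor-complete (a , false) (_ , true) _ d∈ =
    ∈-concatMap-intro {f = pairsWith a} d∈ (there (there (there (here refl))))

  translate : Tagged → Tagged → List (Symbol T K) → List (Rule T (ℤ × ℤ))
  translate a d (inj₁ t ∷ []) = ((⌜ a ⌝ , ⌜ d ⌝) , inj₁ t ∷ []) ∷ []
  translate (a , b) (d , b′) (inj₂ Y ∷ inj₂ Z ∷ []) =
    ((⌜ a , b ⌝ , ⌜ d , b′ ⌝) ,
     inj₂ (⌜ a , b ⌝ , ⌜ Y , b ⌝) ∷ inj₂ (⌜ Z , not b′ ⌝ , ⌜ d , b′ ⌝) ∷ []) ∷ []
  translate _ _ _ = []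

  translateAt : List (Symbol T K) → Tagged × Tagged → List (Rule T (ℤ × ℤ))
  translateAt R (a , d) = translate a d R

  rulesFor : Rule T K → List (Rule T (ℤ × ℤ))
  rulesFor (h , R) = concatMap (translateAt R) (pairsFor h)

  G′ : Grammar T (ℤ × ℤ)
  G′ = grammar (concatMap rulesFor (rules H)) (⌜ start H , true ⌝ , ⌜ start H , true ⌝)

  rule-in-G′ : ∀ {h R a d ρ} → (h , R) ∈ rules H → (a , d) ∈ pairsFor h → ρ ∈ translate a d R →
               ρ ∈ rules G′
  rule-in-G′ {R = R} r p ρ∈ = ∈-concatMap-intro {f = rulesFor} r (∈-concatMap-intro {f = translateAt R} p ρ∈)

  data Origin (ρ : Rule T (ℤ × ℤ)) : Set where
    origin : ∀ {h R a d} → (h , R) ∈ rules H → (a , d) ∈ pairsFor h → ρ ∈ translate a d R → Origin ρ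

  origin-of : ∀ {ρ} → ρ ∈ rules G′ → Origin ρ
  origin-of ρ∈ with (h , R) , r , q ← ∈-concatMap-elim rulesFor (rules H) ρ∈
               with (a , d) , p , ρ∈′ ← ∈-concatMap-elim (translateAt R) (pairsFor h) q =
    origin r p ρ∈′

  translate-root : ∀ {a d R L R″} → (L , R″) ∈ translate a d R → L ≡ (⌜ a ⌝ , ⌜ d ⌝)
  translate-root {R = inj₁ t ∷ []} (here refl) = refl
  translate-root {R = inj₂ Y ∷ inj₂ Z ∷ []} (here refl) = refl

  translate-shape : ∀ {a d R ρ} → ρ ∈ translate a d R → CNFRule ρ × IntPairRule ρ
  translate-shape {R = inj₁ t ∷ []} (here refl) = inj₂ (t , refl) , inj₂ (t , refl)
  translate-shape {R = inj₂ Y ∷ inj₂ Z ∷ []} (here refl) =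
    inj₁ (_ , _ , refl) , inj₁ (_ , _ , _ , _ , refl , refl)

  G′-integer-pair : IsIntegerPairGrammar G′
  G′-integer-pair = All.tabulate (proj₁ ∘′ shape) , All.tabulate (proj₂ ∘′ shape)
    where
    shape : ∀ {ρ} → ρ ∈ rules G′ → CNFRule ρ × IntPairRule ρ
    shape ρ∈ with origin _ _ ρ∈′ ← origin-of ρ∈ = translate-shape ρ∈′

  module TH = ParseTrees H
  module TG′ = ParseTrees G′

  root-injective : ∀ {a d a′ d′} → (⌜ a ⌝ , ⌜ d ⌝) ≡ (⌜ a′ ⌝ , ⌜ d′ ⌝) → a ≡ a′ × d ≡ d′
  root-injective e = ⌜⌝-injective (cong proj₁ e) , ⌜⌝-injective (cong proj₂ e)

  tree-sound : ∀ {a d w} → TG′.Tree (⌜ a ⌝ , ⌜ d ⌝) w → TH.Tree (meaning a d) w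
  translate-sound : ∀ {a d R R″ w} → (meaning a d , R) ∈ rules H →
                    ((⌜ a ⌝ , ⌜ d ⌝) , R″) ∈ translate a d R → TG′.Forest R″ w → TH.Tree (meaning a d) w

  tree-sound (TG′.node r f) with origin r′ p ρ∈ ← origin-of r
    with refl , refl ← root-injective (translate-root ρ∈)
    with refl ← pairsFor-meaning p = translate-sound r′ ρ∈ f

  translate-sound r ρ∈ f with All.lookup cnf r
  translate-sound r (here refl) (TG′.fterm TG′.fnil) | inj₂ (t , refl) = TH.node r (TH.fterm TH.fnil)
  translate-sound {a , b} {d , b′} r (here refl) (TG′.fnt t₁ (TG′.fnt t₂ TG′.fnil)) | inj₁ (Y , Z , refl) =
    TH.node r (TH.fnt (subst (λ h → TH.Tree h _) (meaning-agree a b Y) (tree-sound t₁))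
              (TH.fnt (subst (λ h → TH.Tree h _) (meaning-differ Z b′ d) (tree-sound t₂)) TH.fnil))

  tree-complete : ∀ {h w} → TH.Tree h w → ∀ a d → proj₁ a ∈ nonterminals → proj₁ d ∈ nonterminals →
                  meaning a d ≡ h → TG′.Tree (⌜ a ⌝ , ⌜ d ⌝) w
  tree-complete (TH.node r f) a d a∈ d∈ refl with All.lookup cnf r
  tree-complete (TH.node r (TH.fterm TH.fnil)) a d a∈ d∈ refl | inj₂ (t , refl) =
    TG′.node (rule-in-G′ r (pairsFor-complete a d a∈ d∈) (here refl)) (TG′.fterm TG′.fnil)
  tree-complete (TH.node r (TH.fnt t₁ (TH.fnt t₂ TH.fnil))) (a , b) (d , b′) a∈ d∈ refl | inj₁ (Y , Z , refl) =
    TG′.node (rule-in-G′ r (pairsFor-complete (a , b) (d , b′) a∈ d∈) (here refl))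
      (TG′.fnt (tree-complete t₁ (a , b) (Y , b) a∈ Y∈ (meaning-agree a b Y))
        (TG′.fnt (tree-complete t₂ (Z , not b′) (d , b′) Z∈ d∈ (meaning-differ Z b′ d)) TG′.fnil))
    where
    Y∈ = rhs-nonterminal r (here refl)
    Z∈ = rhs-nonterminal r (there (here refl))

  G′-expresses-H : Expresses G′ H
  G′-expresses-H w =
    mk⇔ (Equivalence.from (LH.language⇔trees w) ∘′ tree-sound ∘′ Equivalence.to (LG′.language⇔trees w))
        (Equivalence.from (LG′.language⇔trees w) ∘′ root-tree ∘′ Equivalence.to (LH.language⇔trees w))
    where
    module LH = Language H
    module LG′ = Language G′
    root-tree : TH.Tree (start H) w → TG′.Tree (start G′) w
    root-tree t = tree-complete t (start H , true) (start H , true) (here refl) (here refl) refl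

lemma1 : {T : Set} (n : ℕ) (G : Grammar T (Fin n)) → NonEmptyRules G →
    ∃[ G' ] (IsIntegerPairGrammar G' × Expresses G' G)
lemma1 n G nonEmpty = G′ , G′-integer-pair , expresses-trans G′-expresses-H H-expresses-G
  where
  open ChomskyNormalForm n G nonEmpty using (H; H-cnf; H-expresses-G; encode; encode-injective)
  open IntegerPairs H H-cnf encode encode-injective using (G′; G′-integer-pair; G′-expresses-H)
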